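{- Let $n\ge0$ and let $w=u_1\cdots u_k$ with $u_1,\dots,u_k\in\{x,y,z\}$. Then \[ \rho_n(w)=\sum_{j=1}^{k}\operatorname{sgn}(u_j)\,x\,u_{j+1}\cdots u_k\,z^n\,u_1\cdots u_{j-1}\,y . \]
   Context: Let $\mathfrak{H}=\mathbb{Q}\langle x,y\rangle$ be the noncommutative polynomial algebra over $\mathbb{Q}$ in $x,y$, and $z=x+y$. Define $\operatorname{sgn}\colon\{x,y,z\}\to\{1,-1,0\}$ by $\operatorname{sgn}(x)=1$, $\operatorname{sgn}(y)=-1$, $\operatorname{sgn}(z)=0$. For $n\ge0$, make $\mathfrak{H}^{\otimes(n+2)}$ an $\mathfrak{H}$-bimodule via $a\diamond(w_1\otimes\cdots\otimes w_{n+2})\diamond b=w_1b\otimes w_2\otimes\cdots\otimes w_{n+1}\otimes aw_{n+2}$. Let $\mathcal{C}_n\colon\mathfrak{H}\to\mathfrak{H}^{\otimes(n+2)}$ be the $\mathbb{Q}$-linear map with $\mathcal{C}_n(1)=0$, $\mathcal{C}_n(x)=x\otimes z^{\otimes n}\otimes y$, $\mathcal{C}_n(y)=-x\otimes z^{\otimes n}\otimes y$, and $\mathcal{C}_n(ww')=\mathcal{C}_n(w)\diamond w'+w\diamond\mathcal{C}_n(w')$. Let $M_n(w_1\otimes\cdots\otimes w_{n+2})=w_1\cdots w_{n+2}$ and $\rho_n=M_n\circ\mathcal{C}_n$. -}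

module Defs where

open import Data.Bool using (if_then_else_)
open import Data.List using (List; []; _∷_; _++_; map; concatMap; foldr; take; drop; length; allFin; lookup)
open import Data.List.Properties using (≡-dec)
open import Data.Vec using (Vec; replicate)
import Data.Vec as Vec
open import Data.Nat using (ℕ; zero; suc)
open import Data.Fin using (Fin)
open import Data.Product using (_×_; _,_)
open import Data.Rational using (ℚ; 0ℚ; 1ℚ; -_; _+_; _*_)
open import Relation.Nullary using (does)
open import Relation.Binary.PropositionalEquality using (_≡_)
open import Relation.Binary using (DecidableEquality)

data Gen : Set where
  gx gy : Gen

_≟G_ : DecidableEquality Gen
gx ≟G gx = Relation.Nullary.yes _≡_.refl
gx ≟G gy = Relation.Nullary.no λ ()
gy ≟G gx = Relation.Nullary.no λ ()
gy ≟G gy = Relation.Nullary.yes _≡_.refl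

Word : Set
Word = List Gen

_≟W_ : DecidableEquality Word
_≟W_ = ≡-dec _≟G_

-- Elements of 𝔥: finite formal ℚ-linear combinations of words
H : Set
H = List (ℚ × Word)

coeff : H → Word → ℚ
coeff [] w = 0ℚ
coeff ((q , v) ∷ p) w = (if does (v ≟W w) then q else 0ℚ) + coeff p w

infix 4 _≈H_
_≈H_ : H → H → Set
p ≈H q = ∀ w → coeff p w ≡ coeff q w

0H : H
0H = []

1H : H
1H = (1ℚ , []) ∷ []

infixl 6 _+H_
_+H_ : H → H → H
_+H_ = _++_

infixl 7 _·H_
_·H_ : ℚ → H → H
c ·H p = map (λ { (q , w) → (c * q , w) }) p

infixl 7 _*H_
_*H_ : H → H → H
p *H r = concatMap (λ { (a , u) → map (λ { (b , v) → (a * b , u ++ v) }) r }) p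

sumH : List H → H
sumH = foldr _+H_ 0H

prodH : List H → H
prodH = foldr _*H_ 1H

wordH : Word → H
wordH w = (1ℚ , w) ∷ []

xH yH zH : H
xH = wordH (gx ∷ [])
yH = wordH (gy ∷ [])
zH = xH +H yH

zpow : ℕ → H
zpow zero = 1H
zpow (suc n) = zH *H zpow n

-- Elements of 𝔥^{⊗(n+2)}: formal ℚ-combinations of pure tensors
-- w₁ ⊗ (w₂ ⊗ ⋯ ⊗ w_{n+1}) ⊗ w_{n+2}
Tensor : ℕ → Set
Tensor n = List (ℚ × H × Vec H n × H)

actL : ∀ {n} → H → Tensor n → Tensor n
actL a = map (λ { (c , f , m , l) → (c , f , m , a *H l) })

actR : ∀ {n} → Tensor n → H → Tensor n
actR t b = map (λ { (c , f , m , l) → (c , f *H b , m , l) }) t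

scaleT : ∀ {n} → ℚ → Tensor n → Tensor n
scaleT q = map (λ { (c , f , m , l) → (q * c , f , m , l) })

Cgen : (n : ℕ) → Gen → Tensor n
Cgen n gx = (1ℚ , xH , replicate n zH , yH) ∷ []
Cgen n gy = ((- 1ℚ) , xH , replicate n zH , yH) ∷ []

-- 𝒞ₙ on words, via 𝒞ₙ(1) = 0 and the Leibniz rule 𝒞ₙ(g w') = 𝒞ₙ(g) ⋄ w' + g ⋄ 𝒞ₙ(w')
Cword : (n : ℕ) → Word → Tensor n
Cword n [] = []
Cword n (g ∷ w) = actR (Cgen n g) (wordH w) ++ actL (wordH (g ∷ [])) (Cword n w)

C : (n : ℕ) → H → Tensor n
C n p = concatMap (λ { (q , w) → scaleT q (Cword n w) }) p

M : ∀ {n} → Tensor n → H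
M t = sumH (map (λ { (c , f , m , l) → c ·H (f *H (prodH (Vec.toList m) *H l)) }) t)

ρ : (n : ℕ) → H → H
ρ n p = M (C n p)

data Letter : Set where
  lx ly lz : Letter

letterH : Letter → H
letterH lx = xH
letterH ly = yH
letterH lz = zH

sgn : Letter → ℚ
sgn lx = 1ℚ
sgn ly = - 1ℚ
sgn lz = 0ℚ

prodL : List Letter → H
prodL us = prodH (map letterH us)

-- Σ_{j=1}^{k} sgn(u_j) x u_{j+1}⋯u_k zⁿ u₁⋯u_{j-1} y   (j as a 0-based Fin index)
rhs : ℕ → List Letter → H
rhs n us = sumH (map term (allFin (length us)))
  where
  term : Fin (length us) → H
  term j = sgn (lookup us j) ·H
             (xH *H (prodL (drop (suc (Data.Fin.toℕ j)) us) *H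
               (zpow n *H (prodL (take (Data.Fin.toℕ j) us) *H yH))))

{-# OPTIONS --safe #-}
-- Unrolling the Leibniz rule 𝒞ₙ(g w′) = 𝒞ₙ(g) ⋄ w′ + g ⋄ 𝒞ₙ(w′) along a word moves the letters
-- already passed into the last tensor factor, so M(a ⋄ 𝒞ₙ(g w′)) = sgn(g) x w′ zⁿ a y + M(a g ⋄ 𝒞ₙ(w′)).
-- Iterating this with the accumulator a, starting from a = 1, produces the j-th summand from the
-- j-th letter. A letter z = x + y enters by linearity, and its two summands cancel because
-- sgn(x) + sgn(y) = 0 = sgn(z). Since elements of 𝔥 are lists of monomials with repetitions,
-- all identities are proved after pairing with an arbitrary linear functional.
module Submission where

open import Defs
open import Data.Nat using (ℕ; zero; suc)
open import Data.Fin using (Fin; toℕ)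
import Data.Fin as Fin
open import Data.List using (List; []; _∷_; _++_; map; concatMap; take; drop; length; lookup; tabulate)
import Data.List.Properties as List
import Data.Vec as Vec
open import Data.Product using (_,_)
open import Data.Bool using (true; false; if_then_else_)
open import Data.Rational using (ℚ; 0ℚ; 1ℚ; -_; _+_; _*_)
import Data.Rational.Properties as ℚ
open import Data.Rational.Solver using (module +-*-Solver)
open +-*-Solver using (solve; _:+_; _:*_; _:=_)
open import Relation.Nullary using (does)
open import Relation.Binary using (Setoid)
import Relation.Binary.Reasoning.Setoid
open import Relation.Binary.PropositionalEquality

eval : (Word → ℚ) → H → ℚ
eval F [] = 0ℚ
eval F ((q , w) ∷ p) = q * F w + eval F p

eval-++ : ∀ F p q → eval F (p ++ q) ≡ eval F p + eval F q
eval-++ F [] q = sym (ℚ.+-identityˡ _)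
eval-++ F ((c , w) ∷ p) q =
  trans (cong (c * F w +_) (eval-++ F p q)) (sym (ℚ.+-assoc (c * F w) (eval F p) (eval F q)))

eval-· : ∀ F k p → eval F (k ·H p) ≡ k * eval F p
eval-· F k [] = sym (ℚ.*-zeroʳ k)
eval-· F k ((c , w) ∷ p) = trans (cong (k * c * F w +_) (eval-· F k p))
  (solve 4 (λ k c a x → k :* c :* a :+ k :* x := k :* (c :* a :+ x)) refl k c (F w) (eval F p))

eval-wordH : ∀ F w → eval F (wordH w) ≡ F w
eval-wordH F w = trans (ℚ.+-identityʳ (1ℚ * F w)) (ℚ.*-identityˡ (F w))

eval-congᶠ : ∀ {F G} → (∀ w → F w ≡ G w) → ∀ p → eval F p ≡ eval G p
eval-congᶠ e [] = refl
eval-congᶠ e ((c , w) ∷ p) = cong₂ (λ a b → c * a + b) (e w) (eval-congᶠ e p)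

eval-+ᶠ : ∀ F G p → eval (λ w → F w + G w) p ≡ eval F p + eval G p
eval-+ᶠ F G [] = sym (ℚ.+-identityˡ _)
eval-+ᶠ F G ((c , w) ∷ p) = trans (cong (c * (F w + G w) +_) (eval-+ᶠ F G p))
  (solve 5 (λ c a b x y → c :* (a :+ b) :+ (x :+ y) := (c :* a :+ x) :+ (c :* b :+ y))
     refl c (F w) (G w) (eval F p) (eval G p))

eval-*ᶠ : ∀ k F p → eval (λ w → k * F w) p ≡ k * eval F p
eval-*ᶠ k F [] = sym (ℚ.*-zeroʳ k)
eval-*ᶠ k F ((c , w) ∷ p) = trans (cong (c * (k * F w) +_) (eval-*ᶠ k F p))
  (solve 4 (λ k c a x → c :* (k :* a) :+ k :* x := k :* (c :* a :+ x)) refl k c (F w) (eval F p))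

eval-0ᶠ : ∀ p → eval (λ _ → 0ℚ) p ≡ 0ℚ
eval-0ᶠ [] = refl
eval-0ᶠ ((c , w) ∷ p) = trans (cong₂ _+_ (ℚ.*-zeroʳ c) (eval-0ᶠ p)) (ℚ.+-identityˡ 0ℚ)

eval-swap : ∀ (K : Word → Word → ℚ) p q →
            eval (λ u → eval (K u) q) p ≡ eval (λ v → eval (λ u → K u v) p) q
eval-swap K [] q = sym (eval-0ᶠ q)
eval-swap K ((c , u) ∷ p) q = begin
    c * eval (K u) q + eval (λ u → eval (K u) q) p
  ≡⟨ cong₂ _+_ (sym (eval-*ᶠ c (K u) q)) (eval-swap K p q) ⟩
    eval (λ v → c * K u v) q + eval (λ v → eval (λ u → K u v) p) q
  ≡⟨ sym (eval-+ᶠ _ _ q) ⟩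
    eval (λ v → c * K u v + eval (λ u → K u v) p) q ∎
  where open ≡-Reasoning

eval-* : ∀ F p q → eval F (p *H q) ≡ eval (λ u → eval (λ v → F (u ++ v)) q) p
eval-* F [] q = refl
eval-* F ((a , u) ∷ p) q =
  trans (eval-++ F (map (λ { (b , v) → (a * b , u ++ v) }) q) (p *H q))
        (cong₂ _+_ (eval-shift q) (eval-* F p q))
  where
  eval-shift : ∀ q → eval F (map (λ { (b , v) → (a * b , u ++ v) }) q) ≡ a * eval (λ v → F (u ++ v)) q
  eval-shift [] = sym (ℚ.*-zeroʳ a)
  eval-shift ((b , v) ∷ q) = trans (cong (a * b * F (u ++ v) +_) (eval-shift q))
    (solve 4 (λ a b x y → a :* b :* x :+ a :* y := a :* (b :* x :+ y))
       refl a b (F (u ++ v)) (eval (λ v → F (u ++ v)) q))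

-- Agreement under every functional implies equality of coefficients (∼⇒≈H), and is far easier
-- to show congruent for the ring operations.
infix 4 _∼_
record _∼_ (p q : H) : Set where
  constructor mk∼
  field eval-∼ : ∀ F → eval F p ≡ eval F q
open _∼_

∼-setoid : Setoid _ _
∼-setoid = record
  { Carrier = H
  ; _≈_ = _∼_
  ; isEquivalence = record
    { refl = mk∼ λ _ → refl
    ; sym = λ e → mk∼ λ F → sym (eval-∼ e F)
    ; trans = λ e e′ → mk∼ λ F → trans (eval-∼ e F) (eval-∼ e′ F)
    }
  }

open Setoid ∼-setoid using () renaming (refl to ∼-refl; sym to ∼-sym)
module ∼-Reasoning = Relation.Binary.Reasoning.Setoid ∼-setoid

coeff-eval : ∀ p w → coeff p w ≡ eval (λ v → if does (v ≟W w) then 1ℚ else 0ℚ) p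
coeff-eval [] w = refl
coeff-eval ((q , v) ∷ p) w = cong₂ _+_ (select (does (v ≟W w))) (coeff-eval p w)
  where
  select : ∀ b → (if b then q else 0ℚ) ≡ q * (if b then 1ℚ else 0ℚ)
  select true = sym (ℚ.*-identityʳ q)
  select false = sym (ℚ.*-zeroʳ q)

∼⇒≈H : ∀ {p q} → p ∼ q → p ≈H q
∼⇒≈H {p} {q} e w = trans (coeff-eval p w) (trans (eval-∼ e _) (sym (coeff-eval q w)))

++-cong : ∀ {p p′ q q′} → p ∼ p′ → q ∼ q′ → p ++ q ∼ p′ ++ q′
++-cong {p} {p′} {q} {q′} e e′ = mk∼ λ F →
  trans (eval-++ F p q) (trans (cong₂ _+_ (eval-∼ e F) (eval-∼ e′ F)) (sym (eval-++ F p′ q′)))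

++-interchange : ∀ p q r s → (p ++ q) ++ (r ++ s) ∼ (p ++ r) ++ (q ++ s)
++-interchange p q r s = mk∼ λ F → begin
    eval F ((p ++ q) ++ (r ++ s))
  ≡⟨ trans (eval-++ F (p ++ q) (r ++ s)) (cong₂ _+_ (eval-++ F p q) (eval-++ F r s)) ⟩
    (eval F p + eval F q) + (eval F r + eval F s)
  ≡⟨ solve 4 (λ a b c d → (a :+ b) :+ (c :+ d) := (a :+ c) :+ (b :+ d))
       refl (eval F p) (eval F q) (eval F r) (eval F s) ⟩
    (eval F p + eval F r) + (eval F q + eval F s)
  ≡⟨ sym (trans (eval-++ F (p ++ r) (q ++ s)) (cong₂ _+_ (eval-++ F p r) (eval-++ F q s))) ⟩
    eval F ((p ++ r) ++ (q ++ s)) ∎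
  where open ≡-Reasoning

·-cong : ∀ k {p q} → p ∼ q → k ·H p ∼ k ·H q
·-cong k {p} {q} e = mk∼ λ F → trans (eval-· F k p) (trans (cong (k *_) (eval-∼ e F)) (sym (eval-· F k q)))

·-assoc : ∀ s t p → (s * t) ·H p ∼ s ·H (t ·H p)
·-assoc s t p = mk∼ λ F → begin
    eval F ((s * t) ·H p)  ≡⟨ eval-· F (s * t) p ⟩
    s * t * eval F p       ≡⟨ ℚ.*-assoc s t (eval F p) ⟩
    s * (t * eval F p)     ≡⟨ sym (trans (eval-· F s (t ·H p)) (cong (s *_) (eval-· F t p))) ⟩
    eval F (s ·H (t ·H p)) ∎
  where open ≡-Reasoning

·-distribʳ : ∀ s t p → s ·H p ++ t ·H p ∼ (s + t) ·H p
·-distribʳ s t p = mk∼ λ F → begin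
    eval F (s ·H p ++ t ·H p)  ≡⟨ trans (eval-++ F (s ·H p) (t ·H p)) (cong₂ _+_ (eval-· F s p) (eval-· F t p)) ⟩
    s * eval F p + t * eval F p ≡⟨ sym (ℚ.*-distribʳ-+ (eval F p) s t) ⟩
    (s + t) * eval F p          ≡⟨ sym (eval-· F (s + t) p) ⟩
    eval F ((s + t) ·H p) ∎
  where open ≡-Reasoning

*-cong : ∀ {p p′ q q′} → p ∼ p′ → q ∼ q′ → p *H q ∼ p′ *H q′
*-cong {p} {p′} {q} {q′} e e′ = mk∼ λ F → begin
    eval F (p *H q)                                    ≡⟨ eval-* F p q ⟩
    eval (λ u → eval (λ v → F (u ++ v)) q) p           ≡⟨ eval-congᶠ (λ u → eval-∼ e′ _) p ⟩
    eval (λ u → eval (λ v → F (u ++ v)) q′) p          ≡⟨ eval-∼ e _ ⟩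
    eval (λ u → eval (λ v → F (u ++ v)) q′) p′         ≡⟨ sym (eval-* F p′ q′) ⟩
    eval F (p′ *H q′) ∎
  where open ≡-Reasoning

*-congˡ : ∀ p {q q′} → q ∼ q′ → p *H q ∼ p *H q′
*-congˡ p = *-cong (∼-refl {p})

*-congʳ : ∀ {p p′} q → p ∼ p′ → p *H q ∼ p′ *H q
*-congʳ q e = *-cong e (∼-refl {q})

*-assoc : ∀ p q r → (p *H q) *H r ∼ p *H (q *H r)
*-assoc p q r = mk∼ λ F → begin
    eval F ((p *H q) *H r)
  ≡⟨ trans (eval-* F (p *H q) r) (eval-* _ p q) ⟩
    eval (λ u → eval (λ v → eval (λ t → F ((u ++ v) ++ t)) r) q) p
  ≡⟨ eval-congᶠ (λ u → eval-congᶠ (λ v → eval-congᶠ (λ t → cong F (List.++-assoc u v t)) r) q) p ⟩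
    eval (λ u → eval (λ v → eval (λ t → F (u ++ (v ++ t))) r) q) p
  ≡⟨ sym (trans (eval-* F p (q *H r)) (eval-congᶠ (λ u → eval-* (λ s → F (u ++ s)) q r) p)) ⟩
    eval F (p *H (q *H r)) ∎
  where open ≡-Reasoning

*-distribˡ : ∀ p q r → p *H (q ++ r) ∼ p *H q ++ p *H r
*-distribˡ p q r = mk∼ λ F → begin
    eval F (p *H (q ++ r))
  ≡⟨ trans (eval-* F p (q ++ r)) (eval-congᶠ (λ u → eval-++ _ q r) p) ⟩
    eval (λ u → eval (λ v → F (u ++ v)) q + eval (λ v → F (u ++ v)) r) p
  ≡⟨ eval-+ᶠ _ _ p ⟩
    eval (λ u → eval (λ v → F (u ++ v)) q) p + eval (λ u → eval (λ v → F (u ++ v)) r) p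
  ≡⟨ sym (trans (eval-++ F (p *H q) (p *H r)) (cong₂ _+_ (eval-* F p q) (eval-* F p r))) ⟩
    eval F (p *H q ++ p *H r) ∎
  where open ≡-Reasoning

*-distribʳ : ∀ p q r → (p ++ q) *H r ∼ p *H r ++ q *H r
*-distribʳ p q r = mk∼ λ F → begin
    eval F ((p ++ q) *H r)
  ≡⟨ trans (eval-* F (p ++ q) r) (eval-++ _ p q) ⟩
    eval (λ u → eval (λ v → F (u ++ v)) r) p + eval (λ u → eval (λ v → F (u ++ v)) r) q
  ≡⟨ sym (trans (eval-++ F (p *H r) (q *H r)) (cong₂ _+_ (eval-* F p r) (eval-* F q r))) ⟩
    eval F (p *H r ++ q *H r) ∎
  where open ≡-Reasoning

*-identityˡ : ∀ p → 1H *H p ∼ p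
*-identityˡ p = mk∼ λ F → trans (eval-* F 1H p) (eval-wordH (λ u → eval (λ v → F (u ++ v)) p) [])

*-identityʳ : ∀ p → p *H 1H ∼ p
*-identityʳ p = mk∼ λ F → trans (eval-* F p 1H)
  (eval-congᶠ (λ u → trans (eval-wordH (λ v → F (u ++ v)) []) (cong F (List.++-identityʳ u))) p)

linExt : (Word → H) → H → H
linExt T = concatMap (λ { (q , w) → q ·H T w })

eval-linExt : ∀ F T p → eval F (linExt T p) ≡ eval (λ w → eval F (T w)) p
eval-linExt F T [] = refl
eval-linExt F T ((q , w) ∷ p) =
  trans (eval-++ F (q ·H T w) (linExt T p)) (cong₂ _+_ (eval-· F q (T w)) (eval-linExt F T p))

linExt-cong : ∀ T {p q} → p ∼ q → linExt T p ∼ linExt T q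
linExt-cong T {p} {q} e = mk∼ λ F →
  trans (eval-linExt F T p) (trans (eval-∼ e _) (sym (eval-linExt F T q)))

linExt-congᶠ : ∀ {T T′} → (∀ w → T w ∼ T′ w) → ∀ p → linExt T p ∼ linExt T′ p
linExt-congᶠ {T} {T′} e p = mk∼ λ F →
  trans (eval-linExt F T p) (trans (eval-congᶠ (λ w → eval-∼ (e w) F) p) (sym (eval-linExt F T′ p)))

linExt-++ : ∀ T p q → linExt T (p ++ q) ∼ linExt T p ++ linExt T q
linExt-++ T p q = mk∼ λ F → cong (eval F) (List.concatMap-++ _ p q)

linExt-++ᶠ : ∀ T T′ p → linExt (λ w → T w ++ T′ w) p ∼ linExt T p ++ linExt T′ p
linExt-++ᶠ T T′ p = mk∼ λ F → begin
    eval F (linExt (λ w → T w ++ T′ w) p)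
  ≡⟨ trans (eval-linExt F _ p) (eval-congᶠ (λ w → eval-++ F (T w) (T′ w)) p) ⟩
    eval (λ w → eval F (T w) + eval F (T′ w)) p
  ≡⟨ eval-+ᶠ _ _ p ⟩
    eval (λ w → eval F (T w)) p + eval (λ w → eval F (T′ w)) p
  ≡⟨ sym (trans (eval-++ F (linExt T p) (linExt T′ p)) (cong₂ _+_ (eval-linExt F T p) (eval-linExt F T′ p))) ⟩
    eval F (linExt T p ++ linExt T′ p) ∎
  where open ≡-Reasoning

linExt-· : ∀ s T p → linExt (λ w → s ·H T w) p ∼ s ·H linExt T p
linExt-· s T p = mk∼ λ F → begin
    eval F (linExt (λ w → s ·H T w) p)
  ≡⟨ trans (eval-linExt F _ p) (eval-congᶠ (λ w → eval-· F s (T w)) p) ⟩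
    eval (λ w → s * eval F (T w)) p
  ≡⟨ eval-*ᶠ s _ p ⟩
    s * eval (λ w → eval F (T w)) p
  ≡⟨ sym (trans (eval-· F s (linExt T p)) (cong (s *_) (eval-linExt F T p))) ⟩
    eval F (s ·H linExt T p) ∎
  where open ≡-Reasoning

linExt-*ˡ : ∀ r T p → linExt (λ w → r *H T w) p ∼ r *H linExt T p
linExt-*ˡ r T p = mk∼ λ F → begin
    eval F (linExt (λ w → r *H T w) p)
  ≡⟨ trans (eval-linExt F _ p) (eval-congᶠ (λ w → eval-* F r (T w)) p) ⟩
    eval (λ w → eval (λ u → eval (λ v → F (u ++ v)) (T w)) r) p
  ≡⟨ eval-swap (λ w u → eval (λ v → F (u ++ v)) (T w)) p r ⟩
    eval (λ u → eval (λ w → eval (λ v → F (u ++ v)) (T w)) p) r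
  ≡⟨ sym (trans (eval-* F r (linExt T p)) (eval-congᶠ (λ u → eval-linExt _ T p) r)) ⟩
    eval F (r *H linExt T p) ∎
  where open ≡-Reasoning

linExt-wordH-* : ∀ q p → linExt (λ w → wordH w *H q) p ∼ p *H q
linExt-wordH-* q p = mk∼ λ F → begin
    eval F (linExt (λ w → wordH w *H q) p)
  ≡⟨ trans (eval-linExt F _ p) (eval-congᶠ (λ w → eval-* F (wordH w) q) p) ⟩
    eval (λ w → eval (λ u → eval (λ v → F (u ++ v)) q) (wordH w)) p
  ≡⟨ eval-congᶠ (λ w → eval-wordH (λ u → eval (λ v → F (u ++ v)) q) w) p ⟩
    eval (λ u → eval (λ v → F (u ++ v)) q) p
  ≡⟨ sym (eval-* F p q) ⟩
    eval F (p *H q) ∎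
  where open ≡-Reasoning

linExt-prefix : ∀ T u p → linExt T (wordH u *H p) ∼ linExt (λ w → T (u ++ w)) p
linExt-prefix T u p = mk∼ λ F → begin
    eval F (linExt T (wordH u *H p))
  ≡⟨ trans (eval-linExt F T (wordH u *H p)) (eval-* (λ w → eval F (T w)) (wordH u) p) ⟩
    eval (λ u′ → eval (λ w → eval F (T (u′ ++ w))) p) (wordH u)
  ≡⟨ eval-wordH (λ u′ → eval (λ w → eval F (T (u′ ++ w))) p) u ⟩
    eval (λ w → eval F (T (u ++ w))) p
  ≡⟨ sym (eval-linExt F _ p) ⟩
    eval F (linExt (λ w → T (u ++ w)) p) ∎
  where open ≡-Reasoning

M-++ : ∀ {n} (t t′ : Tensor n) → M (t ++ t′) ≡ M t ++ M t′
M-++ [] t′ = refl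
M-++ ((c , f , m , l) ∷ t) t′ =
  trans (cong (c ·H (f *H (prodH (Vec.toList m) *H l)) ++_) (M-++ t t′))
        (sym (List.++-assoc (c ·H (f *H (prodH (Vec.toList m) *H l))) (M t) (M t′)))

M-scaleT : ∀ {n} q (t : Tensor n) → M (scaleT q t) ∼ q ·H M t
M-scaleT q [] = ∼-refl
M-scaleT q ((c , f , m , l) ∷ t) = begin
    (q * c) ·H X ++ M (scaleT q t)  ≈⟨ ++-cong (·-assoc q c X) (M-scaleT q t) ⟩
    q ·H (c ·H X) ++ q ·H M t       ≡⟨ sym (List.map-++ _ (c ·H X) (M t)) ⟩
    q ·H (c ·H X ++ M t) ∎
  where
  open ∼-Reasoning
  X = f *H (prodH (Vec.toList m) *H l)

actL-++ : ∀ {n} a (t t′ : Tensor n) → actL a (t ++ t′) ≡ actL a t ++ actL a t′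
actL-++ a t t′ = List.map-++ _ t t′

module _ {n : ℕ} where

  private
    entry-cong : ∀ c f P {l l′} → l ∼ l′ → c ·H (f *H (P *H l)) ∼ c ·H (f *H (P *H l′))
    entry-cong c f P e = ·-cong c (*-congˡ f (*-congˡ P e))

  M-actL-cong : ∀ {a a′} → a ∼ a′ → (t : Tensor n) → M (actL a t) ∼ M (actL a′ t)
  M-actL-cong e [] = ∼-refl
  M-actL-cong e ((c , f , m , l) ∷ t) =
    ++-cong (entry-cong c f (prodH (Vec.toList m)) (*-congʳ l e)) (M-actL-cong e t)

  M-actL-1H : (t : Tensor n) → M (actL 1H t) ∼ M t
  M-actL-1H [] = ∼-refl
  M-actL-1H ((c , f , m , l) ∷ t) =
    ++-cong (entry-cong c f (prodH (Vec.toList m)) (*-identityˡ l)) (M-actL-1H t)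

  M-actL-actL : ∀ a b (t : Tensor n) → M (actL a (actL b t)) ∼ M (actL (a *H b) t)
  M-actL-actL a b [] = ∼-refl
  M-actL-actL a b ((c , f , m , l) ∷ t) =
    ++-cong (entry-cong c f (prodH (Vec.toList m)) (∼-sym (*-assoc a b l))) (M-actL-actL a b t)

  M-actL-++ : ∀ a a′ (t : Tensor n) → M (actL (a ++ a′) t) ∼ M (actL a t) ++ M (actL a′ t)
  M-actL-++ a a′ [] = ∼-refl
  M-actL-++ a a′ ((c , f , m , l) ∷ t) = begin
      c ·H (f *H (P *H ((a ++ a′) *H l))) ++ M (actL (a ++ a′) t)
    ≈⟨ ++-cong entry-++ (M-actL-++ a a′ t) ⟩
      (c ·H (f *H (P *H (a *H l))) ++ c ·H (f *H (P *H (a′ *H l)))) ++ (M (actL a t) ++ M (actL a′ t))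
    ≈⟨ ++-interchange (c ·H (f *H (P *H (a *H l)))) (c ·H (f *H (P *H (a′ *H l)))) (M (actL a t)) (M (actL a′ t)) ⟩
      (c ·H (f *H (P *H (a *H l))) ++ M (actL a t)) ++ (c ·H (f *H (P *H (a′ *H l))) ++ M (actL a′ t)) ∎
    where
    open ∼-Reasoning
    P = prodH (Vec.toList m)
    entry-++ : c ·H (f *H (P *H ((a ++ a′) *H l))) ∼ c ·H (f *H (P *H (a *H l))) ++ c ·H (f *H (P *H (a′ *H l)))
    entry-++ = begin
        c ·H (f *H (P *H ((a ++ a′) *H l)))
      ≈⟨ entry-cong c f P (*-distribʳ a a′ l) ⟩
        c ·H (f *H (P *H (a *H l ++ a′ *H l)))
      ≈⟨ ·-cong c (*-congˡ f (*-distribˡ P (a *H l) (a′ *H l))) ⟩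
        c ·H (f *H (P *H (a *H l) ++ P *H (a′ *H l)))
      ≈⟨ ·-cong c (*-distribˡ f (P *H (a *H l)) (P *H (a′ *H l))) ⟩
        c ·H (f *H (P *H (a *H l)) ++ f *H (P *H (a′ *H l)))
      ≡⟨ List.map-++ _ (f *H (P *H (a *H l))) (f *H (P *H (a′ *H l))) ⟩
        c ·H (f *H (P *H (a *H l))) ++ c ·H (f *H (P *H (a′ *H l))) ∎

sumH-tabulate-cong : ∀ {k} {f g : Fin k → H} → (∀ j → f j ∼ g j) → sumH (tabulate f) ∼ sumH (tabulate g)
sumH-tabulate-cong {zero} e = ∼-refl
sumH-tabulate-cong {suc k} e = ++-cong (e Fin.zero) (sumH-tabulate-cong (λ j → e (Fin.suc j)))

prodH-replicate-zH : ∀ n → prodH (Vec.toList (Vec.replicate n zH)) ≡ zpow n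
prodH-replicate-zH zero = refl
prodH-replicate-zH (suc n) = cong (zH *H_) (prodH-replicate-zH n)

gen : Gen → Letter
gen gx = lx
gen gy = ly

module Coderivation (n : ℕ) where

  summand : ℚ → H → H → H
  summand s D a = s ·H (xH *H (D *H (zpow n *H (a *H yH))))

  summand-cong : ∀ s D {a a′} → a ∼ a′ → summand s D a ∼ summand s D a′
  summand-cong s D e = ·-cong s (*-congˡ xH (*-congˡ D (*-congˡ (zpow n) (*-congʳ yH e))))

  -- The accumulator a collects the letters already passed by the Leibniz rule.
  ρ⋄ : H → Word → H
  ρ⋄ a w = M (actL a (Cword n w))

  ρ-linExt : ∀ p → ρ n p ∼ linExt (ρ⋄ 1H) p
  ρ-linExt [] = ∼-refl
  ρ-linExt ((q , w) ∷ p) = begin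
      M (scaleT q (Cword n w) ++ C n p)       ≡⟨ M-++ (scaleT q (Cword n w)) (C n p) ⟩
      M (scaleT q (Cword n w)) ++ M (C n p)   ≈⟨ ++-cong (M-scaleT q (Cword n w)) (ρ-linExt p) ⟩
      q ·H M (Cword n w) ++ linExt (ρ⋄ 1H) p  ≈⟨ ++-cong (·-cong q (∼-sym (M-actL-1H (Cword n w)))) ∼-refl ⟩
      q ·H ρ⋄ 1H w ++ linExt (ρ⋄ 1H) p ∎
    where open ∼-Reasoning

  entry-summand : ∀ s a w →
    s ·H ((xH *H wordH w) *H (prodH (Vec.toList (Vec.replicate n zH)) *H (a *H yH))) ++ [] ∼ summand s (wordH w) a
  entry-summand s a w
    rewrite List.++-identityʳ (s ·H ((xH *H wordH w) *H (prodH (Vec.toList (Vec.replicate n zH)) *H (a *H yH))))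
          | prodH-replicate-zH n
    = ·-cong s (*-assoc xH (wordH w) (zpow n *H (a *H yH)))

  M-Cgen : ∀ a g w → M (actL a (actR (Cgen n g) (wordH w))) ∼ summand (sgn (gen g)) (wordH w) a
  M-Cgen a gx w = entry-summand 1ℚ a w
  M-Cgen a gy w = entry-summand (- 1ℚ) a w

  ρ⋄-cons : ∀ a g w → ρ⋄ a (g ∷ w) ∼ summand (sgn (gen g)) (wordH w) a ++ ρ⋄ (a *H wordH (g ∷ [])) w
  ρ⋄-cons a g w = begin
      M (actL a (actR (Cgen n g) (wordH w) ++ actL (wordH (g ∷ [])) (Cword n w)))
    ≡⟨ cong M (actL-++ a (actR (Cgen n g) (wordH w)) (actL (wordH (g ∷ [])) (Cword n w))) ⟩
      M (actL a (actR (Cgen n g) (wordH w)) ++ actL a (actL (wordH (g ∷ [])) (Cword n w)))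
    ≡⟨ M-++ (actL a (actR (Cgen n g) (wordH w))) (actL a (actL (wordH (g ∷ [])) (Cword n w))) ⟩
      M (actL a (actR (Cgen n g) (wordH w))) ++ M (actL a (actL (wordH (g ∷ [])) (Cword n w)))
    ≈⟨ ++-cong (M-Cgen a g w) (M-actL-actL a (wordH (g ∷ [])) (Cword n w)) ⟩
      summand (sgn (gen g)) (wordH w) a ++ ρ⋄ (a *H wordH (g ∷ [])) w ∎
    where open ∼-Reasoning

  ρ⋄-cong : ∀ {a a′} → a ∼ a′ → ∀ w → ρ⋄ a w ∼ ρ⋄ a′ w
  ρ⋄-cong e w = M-actL-cong e (Cword n w)

  ρ⋄-++ : ∀ a a′ w → ρ⋄ (a ++ a′) w ∼ ρ⋄ a w ++ ρ⋄ a′ w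
  ρ⋄-++ a a′ w = M-actL-++ a a′ (Cword n w)

  linExt-summand : ∀ s a p → linExt (λ w → summand s (wordH w) a) p ∼ summand s p a
  linExt-summand s a p = begin
      linExt (λ w → s ·H (xH *H (wordH w *H K))) p  ≈⟨ linExt-· s _ p ⟩
      s ·H linExt (λ w → xH *H (wordH w *H K)) p    ≈⟨ ·-cong s (linExt-*ˡ xH _ p) ⟩
      s ·H (xH *H linExt (λ w → wordH w *H K) p)    ≈⟨ ·-cong s (*-congˡ xH (linExt-wordH-* K p)) ⟩
      s ·H (xH *H (p *H K)) ∎
    where
    open ∼-Reasoning
    K = zpow n *H (a *H yH)

  linExt-ρ⋄-gen : ∀ a g p →
    linExt (ρ⋄ a) (wordH (g ∷ []) *H p) ∼ summand (sgn (gen g)) p a ++ linExt (ρ⋄ (a *H wordH (g ∷ []))) p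
  linExt-ρ⋄-gen a g p = begin
      linExt (ρ⋄ a) (wordH (g ∷ []) *H p)
    ≈⟨ linExt-prefix (ρ⋄ a) (g ∷ []) p ⟩
      linExt (λ w → ρ⋄ a (g ∷ w)) p
    ≈⟨ linExt-congᶠ (ρ⋄-cons a g) p ⟩
      linExt (λ w → summand (sgn (gen g)) (wordH w) a ++ ρ⋄ (a *H wordH (g ∷ [])) w) p
    ≈⟨ linExt-++ᶠ _ _ p ⟩
      linExt (λ w → summand (sgn (gen g)) (wordH w) a) p ++ linExt (ρ⋄ (a *H wordH (g ∷ []))) p
    ≈⟨ ++-cong (linExt-summand (sgn (gen g)) a p) ∼-refl ⟩
      summand (sgn (gen g)) p a ++ linExt (ρ⋄ (a *H wordH (g ∷ []))) p ∎
    where open ∼-Reasoning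

  linExt-ρ⋄-letter : ∀ a u p →
    linExt (ρ⋄ a) (letterH u *H p) ∼ summand (sgn u) p a ++ linExt (ρ⋄ (a *H letterH u)) p
  linExt-ρ⋄-letter a lx p = linExt-ρ⋄-gen a gx p
  linExt-ρ⋄-letter a ly p = linExt-ρ⋄-gen a gy p
  linExt-ρ⋄-letter a lz p = begin
      linExt (ρ⋄ a) (zH *H p)
    ≈⟨ linExt-cong (ρ⋄ a) (*-distribʳ xH yH p) ⟩
      linExt (ρ⋄ a) (xH *H p ++ yH *H p)
    ≈⟨ linExt-++ (ρ⋄ a) (xH *H p) (yH *H p) ⟩
      linExt (ρ⋄ a) (xH *H p) ++ linExt (ρ⋄ a) (yH *H p)
    ≈⟨ ++-cong (linExt-ρ⋄-gen a gx p) (linExt-ρ⋄-gen a gy p) ⟩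
      (summand 1ℚ p a ++ A) ++ (summand (- 1ℚ) p a ++ B)
    ≈⟨ ++-interchange (summand 1ℚ p a) A (summand (- 1ℚ) p a) B ⟩
      (summand 1ℚ p a ++ summand (- 1ℚ) p a) ++ (A ++ B)
    ≈⟨ ++-cong (·-distribʳ 1ℚ (- 1ℚ) (xH *H (p *H (zpow n *H (a *H yH))))) A+B ⟩
      -- 1ℚ + - 1ℚ reduces to 0ℚ, i.e. sgn x + sgn y = sgn z holds by computation.
      summand 0ℚ p a ++ linExt (ρ⋄ (a *H zH)) p ∎
    where
    open ∼-Reasoning
    A = linExt (ρ⋄ (a *H xH)) p
    B = linExt (ρ⋄ (a *H yH)) p
    A+B : A ++ B ∼ linExt (ρ⋄ (a *H zH)) p
    A+B = begin
        A ++ B                                             ≈⟨ ∼-sym (linExt-++ᶠ (ρ⋄ (a *H xH)) (ρ⋄ (a *H yH)) p) ⟩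
        linExt (λ w → ρ⋄ (a *H xH) w ++ ρ⋄ (a *H yH) w) p  ≈⟨ linExt-congᶠ (λ w → ∼-sym (ρ⋄-++ (a *H xH) (a *H yH) w)) p ⟩
        linExt (ρ⋄ (a *H xH ++ a *H yH)) p                 ≈⟨ linExt-congᶠ (ρ⋄-cong (∼-sym (*-distribˡ a xH yH))) p ⟩
        linExt (ρ⋄ (a *H zH)) p ∎

  rhs⋄ : H → List Letter → H
  rhs⋄ a us = sumH (tabulate λ j →
    summand (sgn (lookup us j)) (prodL (drop (suc (toℕ j)) us)) (a *H prodL (take (toℕ j) us)))

  linExt-ρ⋄-prodL : ∀ a us → linExt (ρ⋄ a) (prodL us) ∼ rhs⋄ a us
  linExt-ρ⋄-prodL a [] = ∼-refl
  linExt-ρ⋄-prodL a (u ∷ vs) = begin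
      linExt (ρ⋄ a) (letterH u *H prodL vs)
    ≈⟨ linExt-ρ⋄-letter a u (prodL vs) ⟩
      summand (sgn u) (prodL vs) a ++ linExt (ρ⋄ (a *H letterH u)) (prodL vs)
    ≈⟨ ++-cong (summand-cong (sgn u) (prodL vs) (∼-sym (*-identityʳ a))) (linExt-ρ⋄-prodL (a *H letterH u) vs) ⟩
      summand (sgn u) (prodL vs) (a *H 1H) ++ rhs⋄ (a *H letterH u) vs
    ≈⟨ ++-cong ∼-refl
               (sumH-tabulate-cong (λ j → summand-cong (sgn (lookup vs j)) (prodL (drop (suc (toℕ j)) vs))
                                             (*-assoc a (letterH u) (prodL (take (toℕ j) vs))))) ⟩
      rhs⋄ a (u ∷ vs) ∎
    where open ∼-Reasoning

lemma4p4 : (n : ℕ) (us : List Letter) → ρ n (prodL us) ≈H rhs n us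
lemma4p4 n us = ∼⇒≈H (begin
    ρ n (prodL us)              ≈⟨ ρ-linExt (prodL us) ⟩
    linExt (ρ⋄ 1H) (prodL us)   ≈⟨ linExt-ρ⋄-prodL 1H us ⟩
    rhs⋄ 1H us                  ≈⟨ sumH-tabulate-cong (λ j → summand-cong (sgn (lookup us j))
                                     (prodL (drop (suc (toℕ j)) us)) (*-identityˡ (prodL (take (toℕ j) us)))) ⟩
    sumH (tabulate term)        ≡⟨ cong sumH (sym (List.map-tabulate (λ j → j) term)) ⟩
    rhs n us ∎)
  where
  open Coderivation n
  open ∼-Reasoning
  term : Fin (length us) → H
  term j = summand (sgn (lookup us j)) (prodL (drop (suc (toℕ j)) us)) (prodL (take (toℕ j) us))
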